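{- The wall $W$ has a $2$-queue layout such that for all edges $pq$ and $pr$ with $p\prec q\prec r$ or $r\prec q\prec p$ (in the layout's vertex order), the edges $pq$ and $pr$ are in distinct queues.
   Context: The wall is the infinite graph $W$ with vertex set $\mathbb{Z}^2$ and edge set $\{(x,y)(x+1,y): x,y\in\mathbb{Z}\}\cup\{(x,y)(x,y+1): x,y\in\mathbb{Z},\ x+y \text{ even}\}$. A $k$-queue layout of a graph consists of a total order $\preceq$ of its vertex set and a partition of its edge set into $k$ sets (queues) such that no queue contains two edges $ab$ and $cd$ with $a\prec c\prec d\prec b$. -}

module Defs where

open import Data.Integer using (ℤ; +_; _+_)
open import Data.Integer.Divisibility using (_∣_)
open import Data.Fin using (Fin)
open import Data.Nat using (ℕ)
open import Data.Product using (_×_; _,_; Σ)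
open import Data.Sum using (_⊎_)
open import Relation.Binary.PropositionalEquality using (_≡_; _≢_)
open import Relation.Binary.Structures using (IsTotalOrder)

V : Set
V = ℤ × ℤ

-- Oriented adjacency in the wall W (each undirected edge appears in both orientations).
data Edge : V → V → Set where
  hor  : ∀ x y → Edge (x , y) (x + + 1 , y)
  hor' : ∀ x y → Edge (x + + 1 , y) (x , y)
  ver  : ∀ x y → (+ 2) ∣ (x + y) → Edge (x , y) (x , y + + 1)
  ver' : ∀ x y → (+ 2) ∣ (x + y) → Edge (x , y + + 1) (x , y)

Strict : (V → V → Set) → V → V → Set
Strict _≼_ a b = a ≼ b × a ≢ b

record QueueLayout (k : ℕ) : Set₁ where
  field
    _≼_      : V → V → Set
    total    : IsTotalOrder _≡_ _≼_
    queue    : ∀ u v → Edge u v → Fin k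
    wd       : ∀ u v (e : Edge u v) (e' : Edge u v) → queue u v e ≡ queue u v e'
    sym      : ∀ u v (e : Edge u v) (e' : Edge v u) → queue u v e ≡ queue v u e'
    noNest   : ∀ a b c d (e₁ : Edge a b) (e₂ : Edge c d) →
               Strict _≼_ a c → Strict _≼_ c d → Strict _≼_ d b →
               queue a b e₁ ≢ queue c d e₂

SeparatesSameSide : ∀ {k} → QueueLayout k → Set
SeparatesSameSide L = ∀ p q r (e₁ : Edge p q) (e₂ : Edge p r) →
  ((p ≺ q × q ≺ r) ⊎ (r ≺ q × q ≺ p)) → queue p q e₁ ≢ queue p r e₂
  where
    open QueueLayout L
    _≺_ = Strict _≼_

-- Order the vertices row by row, bottom to top and left to right within a row, and put
-- horizontal edges in one queue and vertical edges in the other.  Every edge joins a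
-- vertex to a unit step away from it, and this order is invariant under translations.
-- Two forward unit steps along the same axis therefore cannot nest: translating a ≺ c
-- by the step gives b ≺ d.  And the two neighbours of p along one axis lie on opposite
-- sides of p, so two edges pq, pr in the same queue never have q strictly between p and r.
module Submission where

open import Defs
open import Data.Empty using (⊥; ⊥-elim)
open import Data.Fin using (Fin; zero; suc)
open import Data.Integer
  using (ℤ; +_; _+_; _<_; _≤_; -[1+_]; _≟_; +<+)
open import Data.Integer.Properties
  using ( +-assoc; +-identityʳ; +-monoʳ-<; +-monoˡ-<; +-monoˡ-≤
        ; <⇒≤; <⇒≢; <-trans; <-cmp; <-asym; <-irrefl; ≤-refl; ≤-trans; ≤-antisym; ≤-total)
open import Data.Nat using (z<s)
open import Data.Product using (Σ; _×_; _,_; proj₁; proj₂)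
open import Data.Product.Relation.Binary.Lex.Strict
  using (×-Lex; ×-transitive; ×-total₂; ×-antisymmetric)
open import Data.Sum using (_⊎_; inj₁; inj₂)
open import Function using (_∘_)
open import Function.Definitions using (Injective)
open import Relation.Binary.Definitions using (Irreflexive; Transitive; Asymmetric)
open import Relation.Binary.Structures using (IsTotalOrder)
open import Relation.Binary.PropositionalEquality
  using (_≡_; refl; sym; trans; cong; subst₂; isEquivalence; resp₂)
import Relation.Binary.Construct.NonStrictToStrict as NonStrictToStrict
open import Relation.Nullary using (¬_; yes; no)

data Axis : Set where
  horizontal vertical : Axis

data Direction : Set where
  forward backward : Direction

reverse : Direction → Direction
reverse forward  = backward
reverse backward = forward

unit : Direction → ℤ
unit forward  = + 1
unit backward = -[1+ 0 ]

step : Axis → Direction → V → V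
step horizontal s (x , y) = (x + unit s , y)
step vertical   s (x , y) = (x , y + unit s)

+-unit-inverse : ∀ s i → i + unit s + unit (reverse s) ≡ i
+-unit-inverse s i = trans (+-assoc i (unit s) (unit (reverse s))) (reverse-cancel s)
  where
  reverse-cancel : ∀ s → i + (unit s + unit (reverse s)) ≡ i
  reverse-cancel forward  = +-identityʳ i
  reverse-cancel backward = +-identityʳ i

step-inverse : ∀ a s u → step a (reverse s) (step a s u) ≡ u
step-inverse horizontal s (x , y) = cong (_, y) (+-unit-inverse s x)
step-inverse vertical   s (x , y) = cong (x ,_) (+-unit-inverse s y)

step-injective : ∀ a s → Injective _≡_ _≡_ (step a s)
step-injective a s {u} {v} eq =
  trans (sym (step-inverse a s u)) (trans (cong (step a (reverse s)) eq) (step-inverse a s v))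

axis : ∀ {u v} → Edge u v → Axis
axis (hor _ _)    = horizontal
axis (hor' _ _)   = horizontal
axis (ver _ _ _)  = vertical
axis (ver' _ _ _) = vertical

direction : ∀ {u v} → Edge u v → Direction
direction (hor _ _)    = forward
direction (hor' _ _)   = backward
direction (ver _ _ _)  = forward
direction (ver' _ _ _) = backward

edge-step : ∀ {u v} (e : Edge u v) → v ≡ step (axis e) (direction e) u
edge-step (hor _ _)     = refl
edge-step (hor' x y)    = sym (step-inverse horizontal forward (x , y))
edge-step (ver _ _ _)   = refl
edge-step (ver' x y _)  = sym (step-inverse vertical forward (x , y))

rowMajor : V → ℤ × ℤ
rowMajor (x , y) = (y , x)

infix 4 _≼_ _≺_

_≼_ : V → V → Set
u ≼ v = ×-Lex _≡_ _<_ _≤_ (rowMajor u) (rowMajor v)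

≼-antisym : ∀ {u v} → u ≼ v → v ≼ u → u ≡ v
≼-antisym {x , y} {x' , y'} u≼v v≼u
  with ×-antisymmetric {_≈₂_ = _≡_} sym <-irrefl <-asym ≤-antisym {y , x} {y' , x'} u≼v v≼u
... | refl , refl = refl

≼-trans : Transitive _≼_
≼-trans {u} {v} {w} = ×-transitive {_<₂_ = _≤_} isEquivalence (resp₂ _<_) <-trans ≤-trans
                                   {rowMajor u} {rowMajor v} {rowMajor w}

≼-isTotalOrder : IsTotalOrder _≡_ _≼_
≼-isTotalOrder = record
  { isPartialOrder = record
    { isPreorder = record
      { isEquivalence = isEquivalence
      ; reflexive     = λ { refl → inj₂ (refl , ≤-refl) }
      ; trans         = ≼-trans
      }
    ; antisym = ≼-antisym
    }
  ; total = λ u v → ×-total₂ sym <-cmp ≤-total (rowMajor u) (rowMajor v)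
  }

_≺_ : V → V → Set
_≺_ = Strict _≼_

≺-irrefl : Irreflexive _≡_ _≺_
≺-irrefl = NonStrictToStrict.<-irrefl _≡_ _≼_

≺-trans : Transitive _≺_
≺-trans = NonStrictToStrict.<-trans _≡_ _≼_ (IsTotalOrder.isPartialOrder ≼-isTotalOrder)

≺-asym : Asymmetric _≺_
≺-asym = NonStrictToStrict.<-asym _≡_ _≼_ ≼-antisym

≼-step : ∀ a s {u v} → u ≼ v → step a s u ≼ step a s v
≼-step horizontal s {_ , _} {_ , _} (inj₁ y<y')          = inj₁ y<y'
≼-step horizontal s {_ , _} {_ , _} (inj₂ (refl , x≤x')) = inj₂ (refl , +-monoˡ-≤ (unit s) x≤x')
≼-step vertical   s {_ , _} {_ , _} (inj₁ y<y')          = inj₁ (+-monoˡ-< (unit s) y<y')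
≼-step vertical   s {_ , _} {_ , _} (inj₂ (refl , x≤x')) = inj₂ (refl , x≤x')

≺-step : ∀ a s {u v} → u ≺ v → step a s u ≺ step a s v
≺-step a s (u≼v , u≢v) = ≼-step a s u≼v , u≢v ∘ step-injective a s

i<i+1 : ∀ i → i < i + + 1
i<i+1 i = subst₂ _<_ (+-identityʳ i) refl (+-monoʳ-< i (+<+ z<s))

≺-step-forward : ∀ a u → u ≺ step a forward u
≺-step-forward horizontal (x , y) = inj₂ (refl , <⇒≤ (i<i+1 x)) , <⇒≢ (i<i+1 x) ∘ cong proj₁
≺-step-forward vertical   (x , y) = inj₁ (i<i+1 y) , <⇒≢ (i<i+1 y) ∘ cong proj₂

step-backward-≺ : ∀ a u → step a backward u ≺ u
step-backward-≺ a u =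
  subst₂ _≺_ refl (step-inverse a backward u) (≺-step-forward a (step a backward u))

rowAxis : V → V → Axis
rowAxis (_ , y) (_ , y') with y ≟ y'
... | yes _ = horizontal
... | no _  = vertical

rowAxis-comm : ∀ u v → rowAxis u v ≡ rowAxis v u
rowAxis-comm (_ , y) (_ , y') with y ≟ y' | y' ≟ y
... | yes _    | yes _    = refl
... | no _     | no _     = refl
... | yes y≡y' | no y'≢y  = ⊥-elim (y'≢y (sym y≡y'))
... | no y≢y'  | yes y'≡y = ⊥-elim (y≢y' (sym y'≡y))

rowAxis-sameRow : ∀ x x' y → rowAxis (x , y) (x' , y) ≡ horizontal
rowAxis-sameRow _ _ y with y ≟ y
... | yes _   = refl
... | no y≢y  = ⊥-elim (y≢y refl)

rowAxis-nextRow : ∀ x y → rowAxis (x , y) (x , y + + 1) ≡ vertical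
rowAxis-nextRow _ y with y ≟ y + + 1
... | yes y≡y+1 = ⊥-elim (<⇒≢ (i<i+1 y) y≡y+1)
... | no _      = refl

axis≡rowAxis : ∀ {u v} (e : Edge u v) → axis e ≡ rowAxis u v
axis≡rowAxis (hor x y)    = sym (rowAxis-sameRow x (x + + 1) y)
axis≡rowAxis (hor' x y)   = sym (rowAxis-sameRow (x + + 1) x y)
axis≡rowAxis (ver x y _)  = sym (rowAxis-nextRow x y)
axis≡rowAxis (ver' x y _) =
  trans (sym (rowAxis-nextRow x y)) (rowAxis-comm (x , y) (x , y + + 1))

axisQueue : Axis → Fin 2
axisQueue horizontal = zero
axisQueue vertical   = suc zero

axisQueue-injective : Injective _≡_ _≡_ axisQueue
axisQueue-injective {horizontal} {horizontal} _ = refl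
axisQueue-injective {vertical}   {vertical}   _ = refl

edgeQueue : ∀ u v → Edge u v → Fin 2
edgeQueue u v _ = axisQueue (rowAxis u v)

edgeQueue-axis : ∀ {a b c d} (e₁ : Edge a b) (e₂ : Edge c d) →
                 edgeQueue a b e₁ ≡ edgeQueue c d e₂ → axis e₁ ≡ axis e₂
edgeQueue-axis e₁ e₂ eq =
  trans (axis≡rowAxis e₁) (trans (axisQueue-injective eq) (sym (axis≡rowAxis e₂)))

edge-step-along : ∀ {a u v} (e : Edge u v) → axis e ≡ a → v ≡ step a (direction e) u
edge-step-along e refl = edge-step e

steps-not-nested : ∀ k s t {a b c d} → b ≡ step k s a → d ≡ step k t c →
                   a ≺ c → c ≺ d → d ≺ b → ⊥
steps-not-nested k backward _ refl refl a≺c c≺d d≺b =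
  ≺-asym (step-backward-≺ k _) (≺-trans a≺c (≺-trans c≺d d≺b))
steps-not-nested k forward backward refl refl _ c≺d _ =
  ≺-asym (step-backward-≺ k _) c≺d
steps-not-nested k forward forward refl refl a≺c _ d≺b =
  ≺-asym (≺-step k forward a≺c) d≺b

Between : V → V → V → Set
Between p q r = (p ≺ q × q ≺ r) ⊎ (r ≺ q × q ≺ p)

step-backward-≺-step-forward : ∀ a p → step a backward p ≺ step a forward p
step-backward-≺-step-forward a p = ≺-trans (step-backward-≺ a p) (≺-step-forward a p)

steps-not-between : ∀ a s t {p q r} → q ≡ step a s p → r ≡ step a t p → ¬ Between p q r
steps-not-between a forward  forward  refl refl (inj₁ (_ , q≺q)) = ≺-irrefl refl q≺q
steps-not-between a forward  forward  refl refl (inj₂ (q≺q , _)) = ≺-irrefl refl q≺q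
steps-not-between a backward backward refl refl (inj₁ (_ , q≺q)) = ≺-irrefl refl q≺q
steps-not-between a backward backward refl refl (inj₂ (q≺q , _)) = ≺-irrefl refl q≺q
steps-not-between a forward  backward refl refl (inj₁ (_ , q≺r)) =
  ≺-asym q≺r (step-backward-≺-step-forward a _)
steps-not-between a forward  backward refl refl (inj₂ (_ , q≺p)) = ≺-asym q≺p (≺-step-forward a _)
steps-not-between a backward forward  refl refl (inj₁ (p≺q , _)) = ≺-asym p≺q (step-backward-≺ a _)
steps-not-between a backward forward  refl refl (inj₂ (r≺q , _)) =
  ≺-asym r≺q (step-backward-≺-step-forward a _)

wall-layout : QueueLayout 2
wall-layout = record
  { _≼_    = _≼_
  ; total  = ≼-isTotalOrder
  ; queue  = edgeQueue
  ; wd     = λ _ _ _ _ → refl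
  ; sym    = λ u v _ _ → cong axisQueue (rowAxis-comm u v)
  ; noNest = λ a b c d e₁ e₂ a≺c c≺d d≺b same →
      steps-not-nested (axis e₂) (direction e₁) (direction e₂)
        (edge-step-along e₁ (edgeQueue-axis e₁ e₂ same)) (edge-step e₂) a≺c c≺d d≺b
  }

wall-separatesSameSide : SeparatesSameSide wall-layout
wall-separatesSameSide p q r e₁ e₂ between same =
  steps-not-between (axis e₂) (direction e₁) (direction e₂)
    (edge-step-along e₁ (edgeQueue-axis e₁ e₂ same)) (edge-step e₂) between

lemma12 : Σ (QueueLayout 2) SeparatesSameSide
lemma12 = wall-layout , wall-separatesSameSide
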